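{- Let $p<q$ be prime numbers, $N=pq$, and suppose $2p<q<4p$ and $\gcd(q+1,p)=1$. If $q-p+1\in\mathbb{Z}\text{ - }\mathcal{KS}(N)$, then $\frac{pq}{2p-1}\in(\mathbb{Q}\setminus\mathbb{Z})\text{ - }\mathcal{KS}(N)$.
   Context: For a rational number $\alpha\neq 0$ write $\alpha=\frac{\alpha_1}{\alpha_2}$ with $\alpha_1,\alpha_2$ integers and $\gcd(\alpha_1,\alpha_2)=1$. An integer $N\ge 2$ is called an $\alpha$-Korselt number if $N\neq\alpha$ and $\alpha_2 r-\alpha_1$ divides $\alpha_2 N-\alpha_1$ (in $\mathbb{Z}$; $0$ divides only $0$) for every prime divisor $r$ of $N$. For a subset $\mathbb{A}\subseteq\mathbb{Q}$, $\mathbb{A}\text{ - }\mathcal{KS}(N)$ denotes the set of all $\beta\in\mathbb{A}\setminus\{0,N\}$ such that $N$ is a $\beta$-Korselt number. -}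

module Defs where

open import Data.Nat as ℕ using (ℕ; suc; _≥_)
open import Data.Nat.Divisibility as ℕD using ()
open import Data.Nat.Primality using (Prime)
open import Data.Integer as ℤ using (ℤ; +_)
open import Data.Integer.Divisibility as ℤD using ()
open import Data.Rational as ℚ using (ℚ; ↥_; ↧_; 0ℚ)
open import Data.Product using (Σ; _×_)
open import Relation.Binary.PropositionalEquality using (_≡_; _≢_)
open import Relation.Nullary using (¬_)

ℤ→ℚ : ℤ → ℚ
ℤ→ℚ z = z ℚ./ 1

ℕ→ℚ : ℕ → ℚ
ℕ→ℚ n = ℤ→ℚ (+ n)

IsInteger : ℚ → Set
IsInteger α = Σ ℤ (λ z → α ≡ ℤ→ℚ z)

-- N is an α-Korselt number; α = α₁/α₂ in lowest terms with α₁ = ↥ α, α₂ = ↧ α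
Korselt : ℚ → ℕ → Set
Korselt α N =
  (N ≥ 2) × (α ≢ ℕ→ℚ N) ×
  (∀ r → Prime r → r ℕD.∣ N →
     ((↧ α ℤ.* + r) ℤ.- ↥ α) ℤD.∣ ((↧ α ℤ.* + N) ℤ.- ↥ α))

-- β ∈ 𝔸-KS(N), the subset 𝔸 ⊆ ℚ given as a predicate
InKS : (ℚ → Set) → ℕ → ℚ → Set
InKS 𝔸 N β = 𝔸 β × (β ≢ 0ℚ) × (β ≢ ℕ→ℚ N) × Korselt β N

module Submission where

-- Write p = m + 1, q = 2p + t + 1 (possible since 2p < q) and put
--   d = q + 1 - 2p = t + 2,   s = 2p - 1 = 2m + 1,   N = pq.
-- The denominator s is coprime to p (as 2p = s + 1) and to q (as s < q), so
-- β = pq/(2p-1) is already in lowest terms: β₁ = N, β₂ = s.  Since s ≥ 3, β is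
-- not an integer, which also gives β ≠ 0 and β ≠ N.  The Korselt condition
-- for β at the two prime factors of N reads
--   r = q :  |sq - N| = mq   divides  |sN - N| = 2m·N   (always),
--   r = p :  |sp - N| = pd   divides  2m·N              (iff d ∣ 2m·q).
-- The hypothesis that N is (q-p+1)-Korselt, used at r = p, says that
-- d = |p - (p+d)| divides |N - (p+d)| = m·d + p·2m, hence d ∣ p·2m, and since
-- d + 2p = q + 1 is coprime to p we get d ∣ 2m, which settles r = p.
-- The file first translates the integer divisibility of the Korselt condition
-- into divisibility of natural distances ∣ a - b ∣, then proves a general
-- membership criterion for (ℚ∖ℤ)-KS(N) of a reduced fraction N/(k+1), and
-- finally carries out the arithmetic above in the module Construction.

open import Defs
open import Data.Nat
  using (ℕ; suc; zero; pred; _+_; _*_; _∸_; _<_; _≥_; s≤s; z≤n; ∣_-_∣)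
open import Data.Nat.Primality
  using (Prime; euclidsLemma; prime⇒irreducible; ¬prime[0]; ¬prime[1])
open import Data.Nat.GCD using (gcd)
open import Data.Nat.Divisibility
  using (_∣_; ∣-trans; ∣1⇒≡1; ∣m∣n⇒∣m+n; ∣m+n∣m⇒∣n; ∣n⇒∣m*n; m∣m*n; n∣m*n;
         *-monoʳ-∣)
open import Data.Nat.Coprimality
  using (Coprime; coprime-divisor; prime⇒coprime; gcd≡1⇒coprime; 1-coprimeTo)
  renaming (sym to coprime-sym)
open import Data.Nat.Tactic.RingSolver using (solve-∀)
open import Data.Integer as ℤ using (+_)
import Data.Integer.Divisibility as ℤD
import Data.Integer.Tactic.RingSolver as ℤSolver
open import Data.Integer.GCD using () renaming (gcd to ℤgcd)
open import Data.Rational as ℚ using (mkℚ; ↥_; ↧_; ↧ₙ_)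
open import Data.Product using (_,_)
open import Data.Sum as Sum using (_⊎_; inj₁; inj₂)
open import Data.Empty using (⊥-elim)
open import Function using (id)
open import Relation.Binary.PropositionalEquality
  using (_≡_; _≢_; refl; sym; trans; cong; cong₂; subst; subst₂; module ≡-Reasoning)
open import Relation.Nullary using (¬_)
import Data.Nat.Properties as ℕP
import Data.Integer.Properties as ℤP
import Data.Rational.Properties as ℚP

∣+m-+n∣≡∣m-n∣ : ∀ m n → ℤ.∣ + m ℤ.- + n ∣ ≡ ∣ m - n ∣
∣+m-+n∣≡∣m-n∣ m n rewrite ℤP.m-n≡m⊖n m n with ℕP.≤-total m n
... | inj₁ m≤n = trans (ℤP.∣⊖∣-≤ m≤n) (sym (ℕP.m≤n⇒∣m-n∣≡n∸m m≤n))
... | inj₂ n≤m = trans (ℤP.∣m⊖n∣≡∣n⊖m∣ m n)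
                   (trans (ℤP.∣⊖∣-≤ n≤m) (sym (ℕP.m≤n⇒∣n-m∣≡n∸m n≤m)))

∣m-n∣≡k : ∀ {m n k} → m ≡ n + k → ∣ m - n ∣ ≡ k
∣m-n∣≡k {n = n} {k} refl = trans (ℕP.∣-∣-comm (n + k) n) (ℕP.∣m-m+n∣≡n n k)

∣n-m∣≡k : ∀ {m n k} → m ≡ n + k → ∣ n - m ∣ ≡ k
∣n-m∣≡k {m} {n} eq = trans (ℕP.∣-∣-comm n m) (∣m-n∣≡k eq)

-- For a rational with numerator a ≥ 0 and denominator b, the Korselt
-- divisibility at r is the divisibility of distances ∣ b r - a ∣ ∣ ∣ b N - a ∣.
KorseltDivisibility : ℕ → ℕ → ℕ → ℕ → Set
KorseltDivisibility a b N r = ∣ b * r - a ∣ ∣ ∣ b * N - a ∣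

korselt-divisibility-ℕ : ∀ a b N r →
  (((+ b ℤ.* + r) ℤ.- + a) ℤD.∣ ((+ b ℤ.* + N) ℤ.- + a)) ≡ KorseltDivisibility a b N r
korselt-divisibility-ℕ a b N r = cong₂ _∣_ (distance r) (distance N)
  where
  distance : ∀ x → ℤ.∣ (+ b ℤ.* + x) ℤ.- + a ∣ ≡ ∣ b * x - a ∣
  distance x = trans (cong (λ y → ℤ.∣ y ℤ.- + a ∣) (sym (ℤP.pos-* b x)))
                     (∣+m-+n∣≡∣m-n∣ (b * x) a)

ℕ→ℚ≡mkℚ : ∀ n → ℕ→ℚ n ≡ mkℚ (+ n) 0 (coprime-sym (1-coprimeTo n))
ℕ→ℚ≡mkℚ n = ℚP.normalize-coprime (coprime-sym (1-coprimeTo n))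

integer-korselt : ∀ {n N r} → Korselt (ℕ→ℚ n) N → Prime r → r ∣ N → ∣ r - n ∣ ∣ ∣ N - n ∣
integer-korselt {n} {N} {r} (_ , _ , korselt) r-prime r∣N =
  subst₂ (λ x y → ∣ x - n ∣ ∣ ∣ y - n ∣) (ℕP.*-identityˡ r) (ℕP.*-identityˡ N)
    (subst id (korselt-divisibility-ℕ n 1 N r)
      (subst (λ α → ((↧ α ℤ.* + r) ℤ.- ↥ α) ℤD.∣ ((↧ α ℤ.* + N) ℤ.- ↥ α))
        (ℕ→ℚ≡mkℚ n) (korselt r r-prime r∣N)))

↧ₙ-ℤ→ℚ : ∀ z → ↧ₙ (ℤ→ℚ z) ≡ 1
↧ₙ-ℤ→ℚ z = ℕP.m*n≡1⇒m≡1 (↧ₙ (ℤ→ℚ z)) ℤ.∣ ℤgcd z (+ 1) ∣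
  (trans (sym (ℤP.abs-* (↧ (ℤ→ℚ z)) (ℤgcd z (+ 1)))) (cong ℤ.∣_∣ (ℚP.↧-/ z 1)))

non-integer : ∀ {β} → ↧ₙ β ≢ 1 → ¬ IsInteger β
non-integer ↧ₙβ≢1 (z , refl) = ↧ₙβ≢1 (↧ₙ-ℤ→ℚ z)

-- Being no integer, it differs from 0 and from N automatically.
fraction-in-KS : ∀ {N k} .(cop : Coprime N (suc k)) → k ≢ 0 → N ≥ 2 →
  (∀ r → Prime r → r ∣ N → KorseltDivisibility N (suc k) N r) →
  InKS (λ β → ¬ IsInteger β) N (mkℚ (+ N) k cop)
fraction-in-KS {N} {k} cop k≢0 N≥2 korselt =
  β∉ℤ , (λ β≡0 → β∉ℤ (+ 0 , β≡0)) , β≢N , (N≥2 , β≢N , korselt-ℤ)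
  where
  β∉ℤ : ¬ IsInteger (mkℚ (+ N) k cop)
  β∉ℤ = non-integer (λ k+1≡1 → k≢0 (cong pred k+1≡1))
  β≢N : mkℚ (+ N) k cop ≢ ℕ→ℚ N
  β≢N β≡N = β∉ℤ (+ N , β≡N)
  korselt-ℤ : ∀ r → Prime r → r ∣ N →
    ((+ suc k ℤ.* + r) ℤ.- + N) ℤD.∣ ((+ suc k ℤ.* + N) ℤ.- + N)
  korselt-ℤ r r-prime r∣N =
    subst id (sym (korselt-divisibility-ℕ N (suc k) N r)) (korselt r r-prime r∣N)

coprime-* : ∀ {a b c} → Coprime a b → Coprime a c → Coprime a (b * c)
coprime-* {b = b} a⊥b a⊥c {e} (e∣a , e∣bc) = a⊥c (e∣a , coprime-divisor e⊥b e∣bc)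
  where
  e⊥b : Coprime e b
  e⊥b (f∣e , f∣b) = a⊥b (∣-trans f∣e e∣a , f∣b)

coprime-+-multiple⁻ : ∀ {a n} k → Coprime (a + k * n) n → Coprime a n
coprime-+-multiple⁻ k a+kn⊥n (e∣a , e∣n) = a+kn⊥n (∣m∣n⇒∣m+n e∣a (∣n⇒∣m*n k e∣n) , e∣n)

coprime-pred-multiple : ∀ {a n} k → a + 1 ≡ k * n → Coprime a n
coprime-pred-multiple k a+1≡kn {e} (e∣a , e∣n) =
  ∣1⇒≡1 (∣m+n∣m⇒∣n (subst (e ∣_) (sym a+1≡kn) (∣n⇒∣m*n k e∣n)) e∣a)

prime-factor-of-semiprime : ∀ {p q r} → Prime p → Prime q → Prime r →
  r ∣ p * q → r ≡ p ⊎ r ≡ q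
prime-factor-of-semiprime {p} {q} {r} p-prime q-prime r-prime r∣pq =
  Sum.map (equal-if-divides p-prime) (equal-if-divides q-prime)
    (euclidsLemma p q r-prime r∣pq)
  where
  equal-if-divides : ∀ {s} → Prime s → r ∣ s → r ≡ s
  equal-if-divides s-prime r∣s with prime⇒irreducible s-prime r∣s
  ... | inj₁ r≡1 = ⊥-elim (¬prime[1] (subst Prime r≡1 r-prime))
  ... | inj₂ r≡s = r≡s

difference-plus-one : ∀ {a b c} → a + 1 ≡ b + c → (+ a ℤ.- + b) ℤ.+ + 1 ≡ + c
difference-plus-one {a} {b} {c} a+1≡b+c = begin
  (+ a ℤ.- + b) ℤ.+ + 1   ≡⟨ shift (+ a) (+ b) ⟩
  + (a + 1) ℤ.- + b       ≡⟨ cong (λ x → + x ℤ.- + b) a+1≡b+c ⟩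
  + (b + c) ℤ.- + b       ≡⟨ cancel (+ b) (+ c) ⟩
  + c                     ∎
  where
  open ≡-Reasoning
  shift : ∀ x y → (x ℤ.- y) ℤ.+ ℤ.1ℤ ≡ (x ℤ.+ ℤ.1ℤ) ℤ.- y
  shift = ℤSolver.solve-∀
  cancel : ∀ x y → (x ℤ.+ y) ℤ.- x ≡ y
  cancel = ℤSolver.solve-∀

-- The parametrisation of the theorem: any p ≥ 1 and q > 2p can be written as
--   p = m + 1,  q = 2p + t + 1,  with  d = q + 1 - 2p = t + 2,  s = 2p - 1 = 2m + 1.
-- Parametrised P states P for all m, t in this form; the polynomial identities
-- below are instances, each proved by the ring solver.
Parametrised : (ℕ → ℕ → ℕ → ℕ → ℕ → Set) → Set
Parametrised P = ∀ m t → P m (suc m) (suc (2 * suc m + t)) (suc (suc t)) (suc (m + m))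

q+1≡p+[p+d] : Parametrised λ m p q d s → q + 1 ≡ p + (p + d)
q+1≡p+[p+d] = solve-∀

q+1≡d+2p : Parametrised λ m p q d s → q + 1 ≡ d + 2 * p
q+1≡d+2p = solve-∀

s+1≡2p : Parametrised λ m p q d s → s + 1 ≡ 2 * p
s+1≡2p = solve-∀

q≡s+d : Parametrised λ m p q d s → q ≡ s + d
q≡s+d = solve-∀

pq≡[p+d]+[md+p2m] : Parametrised λ m p q d s → p * q ≡ (p + d) + (m * d + p * (m + m))
pq≡[p+d]+[md+p2m] = solve-∀

pq≡sp+pd : Parametrised λ m p q d s → p * q ≡ s * p + p * d
pq≡sp+pd = solve-∀

sq≡pq+mq : Parametrised λ m p q d s → s * q ≡ p * q + m * q
sq≡pq+mq = solve-∀

2m[pq]≡p[2m]q : Parametrised λ m p q d s → (m + m) * (p * q) ≡ p * (m + m) * q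
2m[pq]≡p[2m]q = solve-∀

2m[pq]≡mq[2p] : Parametrised λ m p q d s → (m + m) * (p * q) ≡ m * q * (2 * p)
2m[pq]≡mq[2p] = solve-∀

module Construction (m t : ℕ) where

  p q d s N : ℕ
  p = suc m
  q = suc (2 * p + t)
  d = suc (suc t)
  s = suc (m + m)
  N = p * q

  N≥2 : N ≥ 2
  N≥2 = s≤s (s≤s z≤n)

  2m≢0 : Prime p → m + m ≢ 0
  2m≢0 p-prime 2m≡0 = ¬prime[1] (subst (λ x → Prime (suc x)) (ℕP.m+n≡0⇒m≡0 m 2m≡0) p-prime)

  -- s is coprime to p (as s + 1 = 2p) and to q (as s < q), hence to N.
  N⊥s : Prime q → Coprime N s
  N⊥s q-prime = coprime-sym (coprime-* s⊥p s⊥q)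
    where
    s⊥p : Coprime s p
    s⊥p = coprime-pred-multiple 2 (s+1≡2p m t)
    s⊥q : Coprime s q
    s⊥q = coprime-sym (prime⇒coprime q-prime
            (subst (s <_) (sym (q≡s+d m t)) (ℕP.m<m+n s (s≤s z≤n))))

  β≡N/s : (q-prime : Prime q) →
    (+ N) ℚ./ suc (2 * p ∸ 2) ≡ mkℚ (+ N) (m + m) (N⊥s q-prime)
  β≡N/s q-prime = trans (cong (λ k → (+ N) ℚ./ suc k) 2p-2≡2m)
                        (ℚP.normalize-coprime (N⊥s q-prime))
    where
    2p-2≡2m : 2 * p ∸ 2 ≡ m + m
    2p-2≡2m = trans (cong (_∸ 2) (sym (s+1≡2p m t))) (ℕP.m+n∸n≡m (m + m) 1)

  α≡p+d : ℤ→ℚ ((+ q ℤ.- + p) ℤ.+ + 1) ≡ ℕ→ℚ (p + d)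
  α≡p+d = cong ℤ→ℚ (difference-plus-one {q} {p} {p + d} (q+1≡p+[p+d] m t))

  -- The hypothesis at r = p: d = ∣ p - (p+d) ∣ divides ∣ N - (p+d) ∣ = m d + p·2m,
  -- so d ∣ p·2m, and d ∣ 2m because d + 2p = q + 1 is coprime to p.
  d∣2m : Coprime (q + 1) p → ∣ p - (p + d) ∣ ∣ ∣ N - (p + d) ∣ → d ∣ m + m
  d∣2m q+1⊥p hyp = coprime-divisor d⊥p (∣m+n∣m⇒∣n d∣md+p2m (n∣m*n m))
    where
    d⊥p : Coprime d p
    d⊥p = coprime-+-multiple⁻ 2 (subst (λ x → Coprime x p) (q+1≡d+2p m t) q+1⊥p)
    d∣md+p2m : d ∣ m * d + p * (m + m)
    d∣md+p2m = subst₂ _∣_ (∣n-m∣≡k {n = p} refl)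
                          (∣m-n∣≡k {n = p + d} (pq≡[p+d]+[md+p2m] m t)) hyp

  -- Since s N - N = 2m N, the Korselt divisibility for N/s at r asks that the
  -- distance ∣ s r - N ∣ divide 2m N.
  korselt-via : ∀ {r x} → ∣ s * r - N ∣ ≡ x → x ∣ (m + m) * N →
    KorseltDivisibility N s N r
  korselt-via ∣sr-N∣≡x x∣2mN =
    subst₂ _∣_ (sym ∣sr-N∣≡x) (sym (∣m-n∣≡k {n = N} refl)) x∣2mN

  -- At r = q: ∣ s q - N ∣ = m q, which divides 2m N = m q · 2p.
  korselt-at-q : KorseltDivisibility N s N q
  korselt-at-q = korselt-via {q} (∣m-n∣≡k {n = N} (sq≡pq+mq m t))
    (subst (m * q ∣_) (sym (2m[pq]≡mq[2p] m t)) (m∣m*n (2 * p)))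

  -- At r = p: ∣ s p - N ∣ = p d, which divides p·2m·q = 2m N once d ∣ 2m.
  korselt-at-p : d ∣ m + m → KorseltDivisibility N s N p
  korselt-at-p d∣2m′ = korselt-via {p} (∣n-m∣≡k {n = s * p} (pq≡sp+pd m t))
    (∣-trans (*-monoʳ-∣ p d∣2m′)
             (subst (p * (m + m) ∣_) (sym (2m[pq]≡p[2m]q m t)) (m∣m*n q)))

  β-in-KS : Prime p → Prime q → Coprime (q + 1) p →
    Korselt (ℕ→ℚ (p + d)) N →
    InKS (λ β → ¬ IsInteger β) N ((+ N) ℚ./ suc (2 * p ∸ 2))
  β-in-KS p-prime q-prime q+1⊥p α-korselt =
    subst (InKS (λ β → ¬ IsInteger β) N) (sym (β≡N/s q-prime))
      (fraction-in-KS (N⊥s q-prime) (2m≢0 p-prime) N≥2 korselt)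
    where
    korselt : ∀ r → Prime r → r ∣ N → KorseltDivisibility N s N r
    korselt r r-prime r∣N with prime-factor-of-semiprime p-prime q-prime r-prime r∣N
    ... | inj₁ refl = korselt-at-p
                        (d∣2m q+1⊥p (integer-korselt {p + d} α-korselt p-prime (m∣m*n q)))
    ... | inj₂ refl = korselt-at-q

proposition4p4 : (p q : ℕ) → Prime p → Prime q → p < q →
    2 * p < q → q < 4 * p → gcd (q + 1) p ≡ 1 →
    InKS IsInteger (p * q) (ℤ→ℚ ((+ q ℤ.- + p) ℤ.+ + 1)) →
    InKS (λ β → ¬ IsInteger β) (p * q) ((+ (p * q)) ℚ./ suc (2 * p ∸ 2))
proposition4p4 zero _ 0-prime = ⊥-elim (¬prime[0] 0-prime)
proposition4p4 (suc m) q p-prime q-prime _ 2p<q _ gcd≡1 (_ , _ , _ , α-korselt)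
  with t , refl ← ℕP.m≤n⇒∃[o]m+o≡n 2p<q =
  β-in-KS p-prime q-prime (gcd≡1⇒coprime gcd≡1)
    (subst (λ α → Korselt α N) α≡p+d α-korselt)
  where open Construction m t
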